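{- Let $S$ be a numerical semigroup with multiplicity $m$, embedding dimension $\nu$ and conductor $f+1=qm-\rho$ for some $q\in\mathbb N$, $0\le\rho\le m-1$. Suppose that $m-\nu\ge\frac{\alpha(\alpha-1)}{2}-1$ for some integer $\alpha$ with $7\le\alpha\le m-2$. If $\left(2+\frac{\alpha-3}{q}\right)\nu\ge m$, then $S$ satisfies Wilf's Conjecture, i.e. $f+1\le\nu n$.
   Context: A numerical semigroup is a submonoid of $(\mathbb N,+)$ with finite complement. $f$ is its Frobenius number (largest integer not in $S$), $m$ its smallest nonzero element, $\nu$ its minimal number of generators, and $n=|\{s\in S: s<f\}|$. -}

module Defs where

open import Data.Nat using (ℕ; zero; suc; _+_; _*_; _≤_; _<_)
open import Data.Bool using (Bool; true; false)
open import Data.List using (List; []; _∷_; length; upTo; filterᵇ)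
open import Data.List.Relation.Unary.All using (All)
open import Data.Product using (Σ; ∃; ∃-syntax; _×_; _,_)
open import Relation.Binary.PropositionalEquality using (_≡_)

record NumericalSemigroup : Set where
  field
    mem      : ℕ → Bool
    zero∈    : mem 0 ≡ true
    closed   : ∀ a b → mem a ≡ true → mem b ≡ true → mem (a + b) ≡ true
    cofinite : ∃[ N ] (∀ x → N ≤ x → mem x ≡ true)

open NumericalSemigroup public

IsFrobenius : NumericalSemigroup → ℕ → Set
IsFrobenius S f = mem S f ≡ false × (∀ x → f < x → mem S x ≡ true)

IsMultiplicity : NumericalSemigroup → ℕ → Set
IsMultiplicity S m =
  0 < m × mem S m ≡ true × (∀ s → 0 < s → mem S s ≡ true → m ≤ s)

Rep : List ℕ → ℕ → Set
Rep [] x = x ≡ 0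
Rep (a ∷ A) x = ∃[ k ] ∃[ y ] (Rep A y × x ≡ k * a + y)

Generates : NumericalSemigroup → List ℕ → Set
Generates S A = All (λ a → mem S a ≡ true) A × (∀ x → mem S x ≡ true → Rep A x)

IsEmbeddingDimension : NumericalSemigroup → ℕ → Set
IsEmbeddingDimension S ν =
  (∃[ A ] (length A ≡ ν × Generates S A)) ×
  (∀ B → Generates S B → ν ≤ length B)

count<  : NumericalSemigroup → ℕ → ℕ
count< S f = length (filterᵇ (mem S) (upTo f))

-- Write c = f + 1 for the conductor and work with the Apéry set Ap of S with respect to m: the m elements
-- w ∈ S with w - m ∉ S, all below c + m. The nonzero Apéry elements that are not a sum of two nonzero elements
-- of S are minimal generators, as is m, so the number δ of decomposable nonzero Apéry elements is at least m - ν.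
-- A decomposable Apéry element is a sum of two nonzero Apéry elements below c, so 2δ ≤ u(u + 1), where u counts
-- the nonzero Apéry elements below c; with α(α - 1) ≤ 2(m - ν) + 2 this gives α ≤ u + 1. The elements of S
-- below c are the u + 1 Apéry ones and the nX elements w + t·m (w ∈ Ap, t ≥ 1), so n ≥ u + 1 + nX.
-- If n ≥ 2q + α - 3 then f + 1 ≤ qm ≤ (2q + α - 3)ν ≤ νn. Otherwise nX ≤ 2q - 4, while m, 2m, …, (q - 1)m
-- already give nX ≥ q - 1, so q ≥ 3. For q = 3 a nonzero Apéry w with w + m < c would push nX to 3, so all
-- decomposable Apéry elements lie in [2c - 2m, c + m), whence m - ν ≤ δ ≤ ρ and the bound follows by
-- computation. For q ≥ 4 there is a pair a < b of nonzero Apéry elements with a + b < c + m (otherwise δ ≤ 1);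
-- the m-chains from 0, a and b give nX ≥ 2q - 4, hence u + 1 = α. Any further Apéry w with w + m < c would give
-- nX ≥ 2q - 3, and without one every decomposable Apéry element lies in a + Ap or b + Ap, so δ ≤ 2u, which
-- contradicts α(α - 1) ≤ 2δ + 2.

module Submission where

open import Level using (0ℓ)
open import Data.Nat using (ℕ; zero; suc; _+_; _*_; _∸_; _≤_; _<_; z≤n; s≤s; s≤s⁻¹; z<s; _≟_; _≤?_; _<?_)
open import Data.Nat.Properties
open import Data.Nat.Tactic.RingSolver using (solve-∀)
open import Data.Bool using (Bool; true)
import Data.Bool as Bool
open import Data.Bool.Properties using (¬-not)
open import Data.List using (List; []; _∷_; length; upTo; filterᵇ; _++_; [_])
open import Data.List.Properties using (length-++; filter-++; upTo-∷ʳ)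
open import Data.List.Membership.Propositional using (_∈_)
open import Data.List.Relation.Unary.Any using (here; there; tail)
open import Data.List.Relation.Unary.All using (All; []; _∷_)
open import Data.Product using (∃; ∃₂; _×_; _,_; proj₁; proj₂)
open import Data.Sum using (_⊎_; inj₁; inj₂; [_,_]′)
open import Data.Empty using (⊥; ⊥-elim)
open import Function using (_∘_; id; case_of_)
open import Relation.Nullary using (¬_; Dec; yes; no; contradiction; _×-dec_; ¬?)
open import Relation.Unary using (Pred; Decidable; ∁; _∩_)
open import Relation.Unary.Properties using (U?; ∁?; _∩?_)
open import Relation.Binary using (tri<; tri≈; tri>)
open import Relation.Binary.PropositionalEquality
  using (_≡_; _≢_; refl; sym; trans; cong; subst; subst₂; module ≡-Reasoning)

open import Defs

private variable
  P Q R W D : Pred ℕ 0ℓ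
  n : ℕ

-- Counting the elements of a decidable set below a bound

count : Decidable P → ℕ → ℕ
count P? zero = zero
count P? (suc n) with P? n
... | yes _ = suc (count P? n)
... | no  _ = count P? n

count-suc-∈ : (P? : Decidable P) → P n → count P? (suc n) ≡ suc (count P? n)
count-suc-∈ {n = n} P? p with P? n
... | yes _ = refl
... | no ¬p = contradiction p ¬p

count-suc-∉ : (P? : Decidable P) → ¬ P n → count P? (suc n) ≡ count P? n
count-suc-∉ {n = n} P? ¬p with P? n
... | yes p = contradiction p ¬p
... | no  _ = refl

count-U : count U? n ≡ n
count-U {zero}  = refl
count-U {suc n} = cong suc count-U

count-mono : (P? : Decidable P) (Q? : Decidable Q) (n : ℕ) →
  (∀ {x} → x < n → P x → Q x) → count P? n ≤ count Q? n
count-mono P? Q? zero    P⊆Q = z≤n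
count-mono P? Q? (suc n) P⊆Q with P? n | Q? n
... | yes p | yes _ = s≤s (count-mono P? Q? n (P⊆Q ∘ m<n⇒m<1+n))
... | yes p | no ¬q = contradiction (P⊆Q (n<1+n n) p) ¬q
... | no  _ | yes _ = m≤n⇒m≤1+n (count-mono P? Q? n (P⊆Q ∘ m<n⇒m<1+n))
... | no  _ | no  _ = count-mono P? Q? n (P⊆Q ∘ m<n⇒m<1+n)

count-partition : (P? : Decidable P) (R? : Decidable R) (n : ℕ) →
  count P? n ≡ count (P? ∩? R?) n + count (P? ∩? ∁? R?) n
count-partition P? R? zero = refl
count-partition P? R? (suc n) with P? n | R? n
... | yes _ | yes _ = cong suc (count-partition P? R? n)
... | yes _ | no  _ = trans (cong suc (count-partition P? R? n)) (sym (+-suc _ _))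
... | no  _ | yes _ = count-partition P? R? n
... | no  _ | no  _ = count-partition P? R? n

count-remove : ∀ {y} (Q? : Decidable Q) (n : ℕ) → y < n → Q y →
  suc (count (Q? ∩? ∁? (_≟ y)) n) ≤ count Q? n
count-remove {y = y} Q? (suc n) y<1+n qy with Q? n | n ≟ y
... | yes _ | yes refl = s≤s (count-mono (Q? ∩? ∁? (_≟ y)) Q? n (λ _ → proj₁))
... | no ¬q | yes refl = contradiction qy ¬q
... | yes _ | no n≢y   = s≤s (count-remove Q? n (≤∧≢⇒< (s≤s⁻¹ y<1+n) (n≢y ∘ sym)) qy)
... | no  _ | no n≢y   = count-remove Q? n (≤∧≢⇒< (s≤s⁻¹ y<1+n) (n≢y ∘ sym)) qy

count-injective : (P? : Decidable P) (Q? : Decidable Q) (n k : ℕ) (g : ℕ → ℕ) →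
  (∀ {x} → x < n → P x → g x < k × Q (g x)) →
  (∀ {x y} → x < n → y < n → P x → P y → g x ≡ g y → x ≡ y) →
  count P? n ≤ count Q? k
count-injective P? Q? zero k g maps inj = z≤n
count-injective P? Q? (suc n) k g maps inj with P? n
... | no _  = count-injective P? Q? n k g (maps ∘ m<n⇒m<1+n)
                (λ x<n y<n → inj (m<n⇒m<1+n x<n) (m<n⇒m<1+n y<n))
... | yes p = ≤-trans (s≤s rest) (count-remove Q? k (proj₁ (maps (n<1+n n) p)) (proj₂ (maps (n<1+n n) p)))
  where
  rest : count P? n ≤ count (Q? ∩? ∁? (_≟ g n)) k
  rest = count-injective P? (Q? ∩? ∁? (_≟ g n)) n k g
    (λ x<n px → proj₁ (maps (m<n⇒m<1+n x<n) px) , proj₂ (maps (m<n⇒m<1+n x<n) px) ,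
                λ gx≡gn → <-irrefl (inj (m<n⇒m<1+n x<n) (n<1+n n) px p gx≡gn) x<n)
    (λ x<n y<n → inj (m<n⇒m<1+n x<n) (m<n⇒m<1+n y<n))

≤count-by-injection : (Q? : Decidable Q) (k n : ℕ) (g : ℕ → ℕ) →
  (∀ {x} → x < k → g x < n × Q (g x)) →
  (∀ {x y} → x < k → y < k → g x ≡ g y → x ≡ y) →
  k ≤ count Q? n
≤count-by-injection Q? k n g maps inj = subst (_≤ count Q? n) count-U
  (count-injective U? Q? k n g (λ x<k _ → maps x<k) (λ x<k y<k _ _ → inj x<k y<k))

count≤-by-injection : (P? : Decidable P) (n k : ℕ) (g : ℕ → ℕ) →
  (∀ {x} → x < n → P x → g x < k) →
  (∀ {x y} → x < n → y < n → P x → P y → g x ≡ g y → x ≡ y) →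
  count P? n ≤ k
count≤-by-injection P? n k g maps inj = subst (count P? n ≤_) count-U
  (count-injective P? U? n k g (λ x<n px → maps x<n px , _) inj)

count≤1 : (P? : Decidable P) (n : ℕ) →
  (∀ {x y} → x < n → y < n → P x → P y → x ≡ y) → count P? n ≤ 1
count≤1 P? n unique = count≤-by-injection P? n 1 (λ _ → 0) (λ _ _ → s≤s z≤n)
  (λ x<n y<n px py _ → unique x<n y<n px py)

count≡0 : (P? : Decidable P) (n : ℕ) → (∀ {x} → x < n → ¬ P x) → count P? n ≡ 0
count≡0 P? n empty = n≤0⇒n≡0
  (count≤-by-injection P? n 0 id (λ x<n px → contradiction px (empty x<n)) (λ _ _ _ _ → id))

count-union : (P? : Decidable P) (Q? : Decidable Q) (R? : Decidable R) (n : ℕ) →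
  (∀ {x} → x < n → P x → Q x ⊎ R x) → count P? n ≤ count Q? n + count R? n
count-union {P = P} {Q = Q} {R = R} P? Q? R? n cover = begin
  count P? n                                  ≡⟨ count-partition P? Q? n ⟩
  count (P? ∩? Q?) n + count (P? ∩? ∁? Q?) n  ≤⟨ +-mono-≤ (count-mono _ Q? n (λ _ → proj₂))
                                                          (count-mono _ R? n only-R) ⟩
  count Q? n + count R? n                     ∎
  where
  open ≤-Reasoning
  only-R : ∀ {x} → x < n → P x × ¬ Q x → R x
  only-R x<n (px , ¬qx) = [ (λ qx → contradiction qx ¬qx) , id ]′ (cover x<n px)

count≤length : (P? : Decidable P) (n : ℕ) (xs : List ℕ) →
  (∀ {x} → x < n → P x → x ∈ xs) → count P? n ≤ length xs
count≤length P? n [] ∈xs = ≤-reflexive (count≡0 P? n (λ x<n px → case ∈xs x<n px of λ ()))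
count≤length P? n (a ∷ xs) ∈a∷xs = begin
  count P? n                                              ≡⟨ count-partition P? (_≟ a) n ⟩
  count (P? ∩? (_≟ a)) n + count (P? ∩? ∁? (_≟ a)) n      ≤⟨ +-mono-≤ at-most-a rest ⟩
  1 + length xs                                           ∎
  where
  open ≤-Reasoning
  at-most-a : count (P? ∩? (_≟ a)) n ≤ 1
  at-most-a = count≤1 _ n (λ _ _ (_ , x≡a) (_ , y≡a) → trans x≡a (sym y≡a))
  rest : count (P? ∩? ∁? (_≟ a)) n ≤ length xs
  rest = count≤length _ n xs (λ x<n (px , x≢a) → tail x≢a (∈a∷xs x<n px))

length-filterᵇ-upTo : (p : ℕ → Bool) (n : ℕ) →
  length (filterᵇ p (upTo n)) ≡ count (λ x → p x Bool.≟ true) n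
length-filterᵇ-upTo p zero = refl
length-filterᵇ-upTo p (suc n) = begin
  length (filterᵇ p (upTo (suc n)))                        ≡⟨ cong (length ∘ filterᵇ p) (sym (upTo-∷ʳ n)) ⟩
  length (filterᵇ p (upTo n ++ [ n ]))                     ≡⟨ cong length (filter-++ _ (upTo n) [ n ]) ⟩
  length (filterᵇ p (upTo n) ++ filterᵇ p [ n ])           ≡⟨ length-++ (filterᵇ p (upTo n)) ⟩
  length (filterᵇ p (upTo n)) + length (filterᵇ p [ n ])   ≡⟨ cong (_+ length (filterᵇ p [ n ])) ih ⟩
  count p? n + length (filterᵇ p [ n ])                    ≡⟨ last ⟩
  count p? (suc n)                                         ∎
  where
  open ≡-Reasoning
  p? : Decidable (λ x → p x ≡ true)
  p? x = p x Bool.≟ true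
  ih : length (filterᵇ p (upTo n)) ≡ count p? n
  ih = length-filterᵇ-upTo p n
  last : count p? n + length (filterᵇ p [ n ]) ≡ count p? (suc n)
  last with p? n
  ... | yes pn rewrite pn = +-comm (count p? n) 1
  ... | no ¬pn rewrite ¬-not ¬pn = +-identityʳ (count p? n)

count-pair-sums : (W? : Decidable W) (D? : Decidable D) (b k : ℕ) →
  (∀ {d} → d < k → D d → ∃₂ λ x y → x ≤ y × y < b × W x × W y × d ≡ x + y) →
  2 * count D? k ≤ count W? b * suc (count W? b)
count-pair-sums W? D? zero k sums =
  ≤-reflexive (cong (2 *_) (count≡0 D? k (λ d<k dd → case sums d<k dd of λ { (_ , _ , _ , () , _) })))
count-pair-sums {W = W} {D = D} W? D? (suc b) k sums = bound (W? b)
  where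
  open ≤-Reasoning
  u : ℕ
  u = count W? b
  WithSummand-b : Pred ℕ 0ℓ
  WithSummand-b d = W b × b ≤ d × d ∸ b ≤ b × W (d ∸ b)
  WithSummand-b? : Decidable WithSummand-b
  WithSummand-b? d = W? b ×-dec b ≤? d ×-dec d ∸ b ≤? b ×-dec W? (d ∸ b)
  nTop nRest : ℕ
  nTop = count (D? ∩? WithSummand-b?) k
  nRest = count (D? ∩? ∁? WithSummand-b?) k

  rest-bound : 2 * nRest ≤ u * suc u
  rest-bound = count-pair-sums W? (D? ∩? ∁? WithSummand-b?) b k smaller-sums
    where
    smaller-sums : ∀ {d} → d < k → D d × ¬ WithSummand-b d →
                   ∃₂ λ x y → x ≤ y × y < b × W x × W y × d ≡ x + y
    smaller-sums d<k (dd , ¬top) with sums d<k dd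
    ... | x , y , x≤y , y<1+b , wx , wy , refl with y ≟ b
    ...   | no y≢b = x , y , x≤y , ≤∧≢⇒< (s≤s⁻¹ y<1+b) y≢b , wx , wy , refl
    ...   | yes refl = contradiction (wy , m≤n+m y x , subst (_≤ y) (sym x+y∸y≡x) x≤y , subst W (sym x+y∸y≡x) wx) ¬top
      where
      x+y∸y≡x : x + y ∸ y ≡ x
      x+y∸y≡x = m+n∸n≡m x y

  top-bound : nTop ≤ count W? (suc b)
  top-bound = count-injective (D? ∩? WithSummand-b?) W? k (suc b) (_∸ b)
    (λ _ (_ , _ , _ , d∸b≤b , wd∸b) → s≤s d∸b≤b , wd∸b)
    (λ _ _ (_ , _ , b≤d , _) (_ , _ , b≤d′ , _) → ∸-cancelʳ-≡ b≤d b≤d′)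

  split : 2 * count D? k ≡ 2 * nTop + 2 * nRest
  split = trans (cong (2 *_) (count-partition D? WithSummand-b? k)) (*-distribˡ-+ 2 nTop nRest)

  bound : Dec (W b) → 2 * count D? k ≤ count W? (suc b) * suc (count W? (suc b))
  bound (no ¬wb) = begin
    2 * count D? k                        ≡⟨ split ⟩
    2 * nTop + 2 * nRest                  ≡⟨ cong (λ z → 2 * z + 2 * nRest) no-tops ⟩
    2 * nRest                             ≤⟨ rest-bound ⟩
    u * suc u                             ≡⟨ cong (λ z → z * suc z) (sym (count-suc-∉ W? ¬wb)) ⟩
    count W? (suc b) * suc (count W? (suc b)) ∎
    where
    no-tops : nTop ≡ 0
    no-tops = count≡0 (D? ∩? WithSummand-b?) k (λ _ (_ , wb , _) → ¬wb wb)
  bound (yes wb) = begin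
    2 * count D? k                        ≡⟨ split ⟩
    2 * nTop + 2 * nRest                  ≤⟨ +-mono-≤ (*-monoʳ-≤ 2 top-bound) rest-bound ⟩
    2 * count W? (suc b) + u * suc u      ≡⟨ cong (λ z → 2 * z + u * suc u) (count-suc-∈ W? wb) ⟩
    2 * suc u + u * suc u                 ≡⟨ sym (*-distribʳ-+ (suc u) 2 u) ⟩
    (2 + u) * suc u                       ≡⟨ *-comm (2 + u) (suc u) ⟩
    suc u * suc (suc u)                   ≡⟨ cong (λ z → z * suc z) (sym (count-suc-∈ W? wb)) ⟩
    count W? (suc b) * suc (count W? (suc b)) ∎

count≤-above : (P? : Decidable P) (l n : ℕ) → (∀ {x} → x < n → P x → l ≤ x) → count P? n ≤ n ∸ l
count≤-above P? l n above = count≤-by-injection P? n (n ∸ l) (_∸ l)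
  (λ x<n px → ∸-monoˡ-< x<n (above x<n px))
  (λ x<n y<n px py → ∸-cancelʳ-≡ (above x<n px) (above y<n py))

excess-multiple : ∀ {x y s t m} → s < t → x + s * m ≡ y + t * m → ∃ λ k → x ≡ y + suc k * m
excess-multiple {x} {y} {s} {t} {m} s<t eq = k , +-cancelʳ-≡ (s * m) x _ (begin
  x + s * m                  ≡⟨ eq ⟩
  y + t * m                  ≡⟨ cong (λ z → y + z * m) (sym (m∸n+n≡m s<t)) ⟩
  y + (k + suc s) * m        ≡⟨ cong (λ z → y + z * m) (+-suc k s) ⟩
  y + (suc k + s) * m        ≡⟨ cong (y +_) (*-distribʳ-+ m (suc k) s) ⟩
  y + (suc k * m + s * m)    ≡⟨ sym (+-assoc y _ (s * m)) ⟩
  y + suc k * m + s * m      ∎)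
  where
  open ≡-Reasoning
  k : ℕ
  k = t ∸ suc s

last-multiple-below : ∀ m {a} c → 0 < m → a < c → ∃ λ t → a + t * m < c × c ≤ a + suc t * m
last-multiple-below m {a} (suc c) 0<m a<1+c with a ≟ c
... | yes refl = 0 , subst (_< suc a) (sym (+-identityʳ a)) (n<1+n a)
                   , subst (λ z → a < a + z) (sym (+-identityʳ m)) (m<m+n a 0<m)
... | no a≢c with last-multiple-below m c 0<m (≤∧≢⇒< (s≤s⁻¹ a<1+c) a≢c)
...   | t , below , above with c ≟ a + suc t * m
...     | no  c≢ = t , m<n⇒m<1+n below , ≤∧≢⇒< above c≢
...     | yes refl = suc t , n<1+n _ , +-monoʳ-< a (m<n+m (suc t * m) 0<m)

c+ρ≡[1+p]m⇒pm<c : ∀ {c ρ p m} → c + ρ ≡ suc p * m → ρ < m → p * m < c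
c+ρ≡[1+p]m⇒pm<c {c} {ρ} {p} {m} c+ρ≡[1+p]m ρ<m = +-cancelʳ-< m (p * m) c (begin-strict
  p * m + m   ≡⟨ +-comm (p * m) m ⟩
  suc p * m   ≡⟨ c+ρ≡[1+p]m ⟨
  c + ρ       <⟨ +-monoʳ-< c ρ<m ⟩
  c + m       ∎)
  where open ≤-Reasoning

large-summands⇒c+m≤ρ+[x+y] : ∀ {c m ρ x y} → c + ρ ≡ 3 * m → c ≤ x + m → c ≤ y + m → c + m ≤ ρ + (x + y)
large-summands⇒c+m≤ρ+[x+y] {c} {m} {ρ} {x} {y} c+ρ≡3m c≤x+m c≤y+m = +-cancelʳ-≤ (3 * m) (c + m) (ρ + (x + y)) (begin
  c + m + 3 * m              ≡⟨ cong (c + m +_) c+ρ≡3m ⟨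
  c + m + (c + ρ)            ≡⟨ regroup c m ρ ⟩
  c + c + (m + ρ)            ≤⟨ +-monoˡ-≤ (m + ρ) (+-mono-≤ c≤x+m c≤y+m) ⟩
  x + m + (y + m) + (m + ρ)  ≡⟨ collect x y m ρ ⟩
  ρ + (x + y) + 3 * m        ∎)
  where
  open ≤-Reasoning
  regroup : ∀ c m ρ → c + m + (c + ρ) ≡ c + c + (m + ρ)
  regroup = solve-∀
  collect : ∀ x y m ρ → x + m + (y + m) + (m + ρ) ≡ ρ + (x + y) + 3 * m
  collect = solve-∀

large-summands⇒c+m≤x+y : ∀ {c m x y} → 3 * m ≤ c → c ≤ x + m → c ≤ y + m → c + m ≤ x + y
large-summands⇒c+m≤x+y {c} {m} {x} {y} 3m≤c c≤x+m c≤y+m = +-cancelʳ-≤ (2 * m) (c + m) (x + y) (begin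
  c + m + 2 * m              ≡⟨ regroup c m ⟩
  c + 3 * m                  ≤⟨ +-monoʳ-≤ c 3m≤c ⟩
  c + c                      ≤⟨ +-mono-≤ c≤x+m c≤y+m ⟩
  x + m + (y + m)            ≡⟨ collect x y m ⟩
  x + y + 2 * m              ∎)
  where
  open ≤-Reasoning
  regroup : ∀ c m → c + m + 2 * m ≡ c + 3 * m
  regroup = solve-∀
  collect : ∀ x y m → x + m + (y + m) ≡ x + y + 2 * m
  collect = solve-∀

α[α∸1]≤u[1+u]+2⇒α≤1+u : ∀ {α u} → 3 ≤ α → α * (α ∸ 1) ≤ u * suc u + 2 → α ≤ suc u
α[α∸1]≤u[1+u]+2⇒α≤1+u {α} {u} 3≤α bound with α ≤? suc u
... | yes α≤1+u = α≤1+u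
... | no  α≰1+u = contradiction bound (<⇒≱ (too-big α 3≤α (≰⇒> α≰1+u)))
  where
  too-big : ∀ α → 3 ≤ α → suc u < α → u * suc u + 2 < α * (α ∸ 1)
  too-big (suc (suc β)) (s≤s (s≤s 1≤β)) (s≤s (s≤s u≤β)) = begin-strict
    u * suc u + 2           ≤⟨ +-monoˡ-≤ 2 (*-mono-≤ u≤β (s≤s u≤β)) ⟩
    β * suc β + 2           <⟨ +-monoʳ-< (β * suc β) (*-monoʳ-< 2 (s≤s 1≤β)) ⟩
    β * suc β + 2 * suc β   ≡⟨ *-distribʳ-+ (suc β) β 2 ⟨
    (β + 2) * suc β         ≡⟨ cong (_* suc β) (+-comm β 2) ⟩
    suc (suc β) * suc β     ∎
    where open ≤-Reasoning

4<α[α∸1] : ∀ {α} → 3 ≤ α → 4 < α * (α ∸ 1)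
4<α[α∸1] 3≤α = <-≤-trans (s≤s (s≤s (s≤s (s≤s (s≤s z≤n))))) (*-mono-≤ 3≤α (∸-monoˡ-≤ 1 3≤α))

4u+2<α[α∸1] : ∀ {α u} → 5 ≤ α → u < α → 4 * u + 2 < α * (α ∸ 1)
4u+2<α[α∸1] {suc γ} {u} (s≤s 4≤γ) (s≤s u≤γ) = begin-strict
  4 * u + 2    ≤⟨ +-monoˡ-≤ 2 (*-monoʳ-≤ 4 u≤γ) ⟩
  4 * γ + 2    <⟨ +-monoʳ-< (4 * γ) (≤-trans (s≤s (s≤s (s≤s z≤n))) 4≤γ) ⟩
  4 * γ + γ    ≡⟨ +-comm (4 * γ) γ ⟩
  5 * γ        ≤⟨ *-monoˡ-≤ γ (s≤s 4≤γ) ⟩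
  suc γ * γ    ∎
  where open ≤-Reasoning

c+ρ≡3m⇒c≤νn : ∀ {c ρ m ν a n} → c + ρ ≡ 3 * m → m ∸ ν ≤ ρ → ν ≤ m → 3 * m ≤ (6 + a) * ν → 5 + a ≤ n →
              c ≤ ν * n
c+ρ≡3m⇒c≤νn {c} {ρ} {m} {ν} {a} {n} c+ρ≡3m e≤ρ ν≤m 3m≤[6+a]ν 5+a≤n = begin
  c                     ≤⟨ c≤3ν+2e ⟩
  3 * ν + 2 * e         ≤⟨ +-monoʳ-≤ (3 * ν) 2e≤[2+a]ν ⟩
  3 * ν + (2 + a) * ν   ≡⟨ *-distribʳ-+ ν 3 (2 + a) ⟨
  (5 + a) * ν           ≤⟨ *-monoˡ-≤ ν 5+a≤n ⟩
  n * ν                 ≡⟨ *-comm n ν ⟩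
  ν * n                 ∎
  where
  open ≤-Reasoning
  e : ℕ
  e = m ∸ ν
  3m≡3ν+3e : 3 * m ≡ 3 * ν + 3 * e
  3m≡3ν+3e = trans (cong (3 *_) (sym (m+[n∸m]≡n ν≤m))) (*-distribˡ-+ 3 ν e)

  c≤3ν+2e : c ≤ 3 * ν + 2 * e
  c≤3ν+2e = +-cancelʳ-≤ e c (3 * ν + 2 * e) (begin
    c + e                 ≤⟨ +-monoʳ-≤ c e≤ρ ⟩
    c + ρ                 ≡⟨ trans c+ρ≡3m 3m≡3ν+3e ⟩
    3 * ν + 3 * e         ≡⟨ split-3e ν e ⟩
    3 * ν + 2 * e + e     ∎)
    where
    split-3e : ∀ ν e → 3 * ν + 3 * e ≡ 3 * ν + 2 * e + e
    split-3e = solve-∀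

  3e≤[3+a]ν : 3 * e ≤ (3 + a) * ν
  3e≤[3+a]ν = +-cancelˡ-≤ (3 * ν) (3 * e) ((3 + a) * ν) (begin
    3 * ν + 3 * e         ≡⟨ 3m≡3ν+3e ⟨
    3 * m                 ≤⟨ 3m≤[6+a]ν ⟩
    (6 + a) * ν           ≡⟨ *-distribʳ-+ ν 3 (3 + a) ⟩
    3 * ν + (3 + a) * ν   ∎)

  2e≤[2+a]ν : 2 * e ≤ (2 + a) * ν
  2e≤[2+a]ν = *-cancelˡ-≤ 3 (begin
    3 * (2 * e)               ≡⟨ swap e ⟩
    2 * (3 * e)               ≤⟨ *-monoʳ-≤ 2 3e≤[3+a]ν ⟩
    2 * ((3 + a) * ν)         ≤⟨ m≤m+n (2 * ((3 + a) * ν)) (a * ν) ⟩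
    2 * ((3 + a) * ν) + a * ν ≡⟨ regroup a ν ⟩
    3 * ((2 + a) * ν)         ∎)
    where
    swap : ∀ e → 3 * (2 * e) ≡ 2 * (3 * e)
    swap = solve-∀
    regroup : ∀ a ν → 2 * ((3 + a) * ν) + a * ν ≡ 3 * ((2 + a) * ν)
    regroup = solve-∀

select : {A : Set} → ℕ → (ℕ → A) → (ℕ → A) → ℕ → A
select k φ ψ j with j <? k
... | yes _ = φ j
... | no  _ = ψ (j ∸ k)

select-< : ∀ {A : Set} {k j} (φ ψ : ℕ → A) → j < k → select k φ ψ j ≡ φ j
select-< {k = k} {j} φ ψ j<k with j <? k
... | yes _   = refl
... | no j≮k = contradiction j<k j≮k

select-+ : ∀ {A : Set} k i (φ ψ : ℕ → A) → select k φ ψ (k + i) ≡ ψ i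
select-+ k i φ ψ with k + i <? k
... | yes k+i<k = contradiction (m≤m+n k i) (<⇒≱ k+i<k)
... | no  _     = cong ψ (m+n∸m≡n k i)

select-preserves : ∀ {A : Set} {P : A → Set} k {φ ψ : ℕ → A} →
                   (∀ i → P (φ i)) → (∀ i → P (ψ i)) → ∀ j → P (select k φ ψ j)
select-preserves k Pφ Pψ j with j <? k
... | yes _ = Pφ j
... | no  _ = Pψ (j ∸ k)

<-+-split : ∀ {j} k l → j < k + l → j < k ⊎ ∃ λ i → i < l × j ≡ k + i
<-+-split {j} k l j<k+l with j <? k
... | yes j<k = inj₁ j<k
... | no  j≮k = inj₂ (j ∸ k , +-cancelˡ-< k (j ∸ k) l (subst (_< k + l) j≡k+[j∸k] j<k+l) , j≡k+[j∸k])
  where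
  j≡k+[j∸k] : j ≡ k + (j ∸ k)
  j≡k+[j∸k] = sym (m+[n∸m]≡n (≮⇒≥ j≮k))

-- The Apéry set of S with respect to its multiplicity

module Semigroup (S : NumericalSemigroup) {f m : ℕ}
                 (frob : IsFrobenius S f) (mult : IsMultiplicity S m) where

  c : ℕ
  c = suc f

  Mem : Pred ℕ 0ℓ
  Mem x = mem S x ≡ true

  Mem? : Decidable Mem
  Mem? x = mem S x Bool.≟ true

  mem-+ : ∀ {a b} → Mem a → Mem b → Mem (a + b)
  mem-+ {a} {b} = closed S a b

  mem-* : ∀ k {a} → Mem a → Mem (k * a)
  mem-* zero    _  = zero∈ S
  mem-* (suc k) sa = mem-+ sa (mem-* k sa)

  0<m : 0 < m
  0<m = proj₁ mult

  mem-m : Mem m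
  mem-m = proj₁ (proj₂ mult)

  m≤ : ∀ {x} → Mem x → 0 < x → m ≤ x
  m≤ {x} sx 0<x = proj₂ (proj₂ mult) x 0<x sx

  mem-≥c : ∀ {x} → c ≤ x → Mem x
  mem-≥c {x} = proj₂ frob x

  ¬mem-f : ¬ Mem f
  ¬mem-f sf with trans (sym (proj₁ frob)) sf
  ... | ()

  mem-+* : ∀ {a} k → Mem a → Mem (a + k * m)
  mem-+* k sa = mem-+ sa (mem-* k mem-m)

  Apery : Pred ℕ 0ℓ
  Apery w = Mem w × ¬ (m ≤ w × Mem (w ∸ m))

  Apery? : Decidable Apery
  Apery? w = Mem? w ×-dec ¬? (m ≤? w ×-dec Mem? (w ∸ m))

  apery-0 : Apery 0
  apery-0 = zero∈ S , λ (m≤0 , _) → <⇒≱ 0<m m≤0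

  ¬apery-m : ¬ Apery m
  ¬apery-m (_ , ¬m-m∈S) = ¬m-m∈S (≤-refl , subst Mem (sym (n∸n≡0 m)) (zero∈ S))

  apery<c+m : ∀ {w} → Apery w → w < c + m
  apery<c+m {w} (_ , ¬w-m∈S) with w <? c + m
  ... | yes w<c+m = w<c+m
  ... | no  w≮c+m = contradiction (m≤w , mem-≥c c≤w∸m) ¬w-m∈S
    where
    m≤w : m ≤ w
    m≤w = ≤-trans (m≤n+m m c) (≮⇒≥ w≮c+m)
    c≤w∸m : c ≤ w ∸ m
    c≤w∸m = subst (_≤ w ∸ m) (m+n∸n≡m c m) (∸-monoˡ-≤ m (≮⇒≥ w≮c+m))

  ¬apery-+m : ∀ {a} k → Mem a → ¬ Apery (a + suc k * m)
  ¬apery-+m {a} k sa (_ , ¬x-m∈S) = ¬x-m∈S (m≤x , subst Mem (sym x∸m≡a+km) (mem-+* k sa))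
    where
    m≤x : m ≤ a + suc k * m
    m≤x = ≤-trans (m≤m+n m (k * m)) (m≤n+m (suc k * m) a)
    x∸m≡a+km : a + suc k * m ∸ m ≡ a + k * m
    x∸m≡a+km = trans (+-∸-assoc a (m≤m+n m (k * m))) (cong (a +_) (m+n∸m≡n m (k * m)))

  apery-cancel : ∀ {a b} i j → Apery a → Apery b → a + i * m ≡ b + j * m → a ≡ b × i ≡ j
  apery-cancel {a} {b} i j apa apb eq with <-cmp i j
  ... | tri< i<j _ _ = let k , a≡b+[1+k]m = excess-multiple i<j eq in
                       contradiction (subst Apery a≡b+[1+k]m apa) (¬apery-+m k (proj₁ apb))
  ... | tri> _ _ j<i = let k , b≡a+[1+k]m = excess-multiple j<i (sym eq) in
                       contradiction (subst Apery b≡a+[1+k]m apb) (¬apery-+m k (proj₁ apa))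
  ... | tri≈ _ i≡j _ = +-cancelʳ-≡ (i * m) a b (trans eq (cong (λ t → b + t * m) (sym i≡j))) , i≡j

  aperyRep : ℕ → ℕ → ℕ
  aperyRep zero    y = y
  aperyRep (suc k) y with m ≤? y ×-dec Mem? (y ∸ m)
  ... | yes _ = aperyRep k (y ∸ m)
  ... | no  _ = y

  aperyRep-spec : ∀ k {y} → Mem y → y ≤ k →
                  Apery (aperyRep k y) × ∃ λ t → aperyRep k y + t * m ≡ y
  aperyRep-spec zero    _  z≤n = apery-0 , 0 , refl
  aperyRep-spec (suc k) {y} sy y≤1+k with m ≤? y ×-dec Mem? (y ∸ m)
  ... | no  ¬down = (sy , ¬down) , 0 , +-identityʳ y
  ... | yes (m≤y , sy∸m) =
    let apw , t , w+tm≡y∸m = aperyRep-spec k sy∸m (≤-trans (∸-monoʳ-≤ y 0<m) (∸-monoˡ-≤ 1 y≤1+k))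
        w = aperyRep k (y ∸ m)
    in apw , suc t , (begin
      w + (m + t * m)  ≡⟨ cong (w +_) (+-comm m (t * m)) ⟩
      w + (t * m + m)  ≡⟨ sym (+-assoc w (t * m) m) ⟩
      w + t * m + m    ≡⟨ cong (_+ m) w+tm≡y∸m ⟩
      y ∸ m + m        ≡⟨ m∸n+n≡m m≤y ⟩
      y                ∎)
    where open ≡-Reasoning

  private
    multiples-gap : ∀ {w s t} → s < t → w + s * m + m ≤ w + t * m
    multiples-gap {w} {s} {t} s<t = begin
      w + s * m + m    ≡⟨ +-assoc w (s * m) m ⟩
      w + (s * m + m)  ≡⟨ cong (w +_) (+-comm (s * m) m) ⟩
      w + suc s * m    ≤⟨ +-monoʳ-≤ w (*-monoˡ-≤ m s<t) ⟩
      w + t * m        ∎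
      where open ≤-Reasoning

    window-< : ∀ {w s t i j} → j < m → s < t → w + s * m ≡ c + i → w + t * m ≡ c + j → ⊥
    window-< {w} {s} {t} {i} {j} j<m s<t eqi eqj = <⇒≱ (+-monoʳ-< c j<m) (begin
      c + m          ≤⟨ +-monoˡ-≤ m (m≤m+n c i) ⟩
      c + i + m      ≡⟨ cong (_+ m) (sym eqi) ⟩
      w + s * m + m  ≤⟨ multiples-gap s<t ⟩
      w + t * m      ≡⟨ eqj ⟩
      c + j          ∎)
      where open ≤-Reasoning

    window : ∀ {w s t i j} → i < m → j < m → w + s * m ≡ c + i → w + t * m ≡ c + j → i ≡ j
    window {s = s} {t} i<m j<m eqi eqj with <-cmp s t
    ... | tri< s<t _ _ = ⊥-elim (window-< j<m s<t eqi eqj)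
    ... | tri> _ _ t<s = ⊥-elim (window-< i<m t<s eqj eqi)
    ... | tri≈ _ refl _ = +-cancelˡ-≡ c _ _ (trans (sym eqi) eqj)

  m≤count-Apery : m ≤ count Apery? (c + m)
  m≤count-Apery = ≤count-by-injection Apery? m (c + m) rep
    (λ i<m → apery<c+m (proj₁ (spec _)) , proj₁ (spec _))
    (λ {i} {j} i<m j<m repi≡repj →
      let _ , s , eqi = spec i ; _ , t , eqj = spec j
      in window {w = rep i} {s} {t} i<m j<m eqi (trans (cong (_+ t * m) repi≡repj) eqj))
    where
    rep : ℕ → ℕ
    rep i = aperyRep (c + i) (c + i)
    spec : ∀ i → Apery (rep i) × ∃ λ t → rep i + t * m ≡ c + i
    spec i = aperyRep-spec (c + i) (mem-≥c (m≤m+n c i)) ≤-refl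

  Decomposable : Pred ℕ 0ℓ
  Decomposable x = ∃ λ a → a < x × 0 < a × Mem a × Mem (x ∸ a)

  Decomposable? : Decidable Decomposable
  Decomposable? x = anyUpTo? (λ a → 0 <? a ×-dec Mem? a ×-dec Mem? (x ∸ a)) x

  Primitive : Pred ℕ 0ℓ
  Primitive x = Mem x × 0 < x × ¬ Decomposable x

  Primitive? : Decidable Primitive
  Primitive? x = Mem? x ×-dec 0 <? x ×-dec ¬? (Decomposable? x)

  primitive-irreducible : ∀ {x y z} → Primitive x → Mem y → Mem z → x ≡ y + z → y ≡ 0 ⊎ z ≡ 0
  primitive-irreducible {y = zero}           _ _ _ _ = inj₁ refl
  primitive-irreducible {y = suc _} {zero}   _ _ _ _ = inj₂ refl
  primitive-irreducible {y = suc y} {suc z} (_ , _ , ¬dec) sy sz refl =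
    contradiction (suc y , m<m+n (suc y) z<s , z<s , sy , subst Mem (sym (m+n∸m≡n (suc y) (suc z))) sz) ¬dec

  m-primitive : Primitive m
  m-primitive = mem-m , 0<m , λ (a , a<m , 0<a , sa , _) → <⇒≱ a<m (m≤ sa 0<a)

  private
    primitive≡multiple : ∀ {x a} k → Primitive x → Mem a → x ≡ k * a → x ≡ a
    primitive≡multiple zero (_ , 0<x , _) _ refl = contradiction 0<x (<-irrefl refl)
    primitive≡multiple {x} {a} (suc k) px sa x≡ka with primitive-irreducible px sa (mem-* k sa) x≡ka
    ... | inj₂ ka≡0 = trans x≡ka (trans (cong (a +_) ka≡0) (+-identityʳ a))
    ... | inj₁ refl = contradiction (trans x≡ka (*-zeroʳ (suc k))) (λ x≡0 → <-irrefl (sym x≡0) (proj₁ (proj₂ px)))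

    rep-mem : ∀ {A y} → All Mem A → Rep A y → Mem y
    rep-mem []         refl                   = zero∈ S
    rep-mem (sa ∷ sA) (k , y , ry , refl) = mem-+ (mem-* k sa) (rep-mem sA ry)

    primitive∈ : ∀ {A x} → All Mem A → Primitive x → Rep A x → x ∈ A
    primitive∈ []         (_ , 0<x , _) refl = contradiction 0<x (<-irrefl refl)
    primitive∈ {a ∷ A} (sa ∷ sA) px (k , y , ry , x≡ka+y)
      with primitive-irreducible px (mem-* k sa) (rep-mem sA ry) x≡ka+y
    ... | inj₁ ka≡0 = there (primitive∈ sA px (subst (Rep A) (sym (trans x≡ka+y (cong (_+ y) ka≡0))) ry))
    ... | inj₂ refl = here (primitive≡multiple k px sa (trans x≡ka+y (+-identityʳ (k * a))))

  primitive∈generators : ∀ {A x} → Generates S A → Primitive x → x ∈ A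
  primitive∈generators {x = x} (sA , gen) px = primitive∈ sA px (gen x (proj₁ px))

  Apery⁺ : Pred ℕ 0ℓ
  Apery⁺ = Apery ∩ (0 <_)

  Apery⁺? : Decidable Apery⁺
  Apery⁺? = Apery? ∩? (0 <?_)

  DecomposableApery : Pred ℕ 0ℓ
  DecomposableApery = Apery⁺ ∩ Decomposable

  DecomposableApery? : Decidable DecomposableApery
  DecomposableApery? = Apery⁺? ∩? Decomposable?

  δ : ℕ
  δ = count DecomposableApery? (c + m)

  m≤ν+δ : ∀ {ν} → IsEmbeddingDimension S ν → m ≤ ν + δ
  m≤ν+δ {ν} ((A , |A|≡ν , gen) , _) = begin
    m                                     ≤⟨ m≤count-Apery ⟩
    count Apery? (c + m)                  ≡⟨ count-partition Apery? (0 <?_) (c + m) ⟩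
    count Apery⁺? (c + m) + z             ≡⟨ cong (_+ z) (count-partition Apery⁺? Decomposable? (c + m)) ⟩
    δ + π + z                             ≤⟨ +-monoʳ-≤ (δ + π) z≤1 ⟩
    δ + π + 1                             ≡⟨ trans (+-assoc δ π 1) (cong (δ +_) (+-comm π 1)) ⟩
    δ + suc π                             ≤⟨ +-monoʳ-≤ δ 1+π≤ν ⟩
    δ + ν                                 ≡⟨ +-comm δ ν ⟩
    ν + δ                                 ∎
    where
    open ≤-Reasoning
    z π : ℕ
    z = count (Apery? ∩? ∁? (0 <?_)) (c + m)
    π = count (Apery⁺? ∩? ∁? Decomposable?) (c + m)
    ¬0<⇒≡0 : ∀ {x} → ¬ 0 < x → x ≡ 0
    ¬0<⇒≡0 = n≤0⇒n≡0 ∘ ≮⇒≥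
    z≤1 : z ≤ 1
    z≤1 = count≤1 (Apery? ∩? ∁? (0 <?_)) (c + m) (λ _ _ (_ , x≮0) (_ , y≮0) → trans (¬0<⇒≡0 x≮0) (sym (¬0<⇒≡0 y≮0)))
    Primitive≢m? : Decidable (Primitive ∩ ∁ (_≡ m))
    Primitive≢m? = Primitive? ∩? ∁? (_≟ m)
    primitive≢m : ∀ {x} → x < c + m → (Apery⁺ ∩ ∁ Decomposable) x → (Primitive ∩ ∁ (_≡ m)) x
    primitive≢m _ (((sx , ¬down) , 0<x) , ¬dec) = (sx , 0<x , ¬dec) , λ { refl → ¬apery-m (sx , ¬down) }
    1+π≤ν : suc π ≤ ν
    1+π≤ν = begin
      suc π                               ≤⟨ s≤s (count-mono (Apery⁺? ∩? ∁? Decomposable?) Primitive≢m? (c + m) primitive≢m) ⟩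
      suc (count Primitive≢m? (c + m))    ≤⟨ count-remove Primitive? (c + m) (m<n+m m z<s) m-primitive ⟩
      count Primitive? (c + m)            ≤⟨ count≤length Primitive? (c + m) A (λ _ → primitive∈generators gen) ⟩
      length A                            ≡⟨ |A|≡ν ⟩
      ν                                   ∎

  apery-summand : ∀ {a b} → Apery (a + b) → Mem a → Mem b → Apery a
  apery-summand {a} {b} (_ , ¬a+b-m∈S) sa sb =
    sa , λ (m≤a , sa∸m) → ¬a+b-m∈S (≤-trans m≤a (m≤m+n a b) , subst Mem (sym (+-∸-comm b m≤a)) (mem-+ sa∸m sb))

  private
    small-summand : ∀ {a b d} → a + b ≡ d → d < c + m → Apery d → Mem a → Mem b → 0 < a → 0 < b →
                    Apery⁺ a × a < c
    small-summand {a} {b} refl a+b<c+m apab sa sb 0<a 0<b =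
      (apery-summand apab sa sb , 0<a) ,
      +-cancelʳ-< m a c (≤-<-trans (+-monoʳ-≤ a (m≤ sb 0<b)) a+b<c+m)

  decomposableApery-sum : ∀ {d} → d < c + m → DecomposableApery d →
    ∃₂ λ x y → x ≤ y × y < c × Apery⁺ x × Apery⁺ y × d ≡ x + y
  decomposableApery-sum {d} d<c+m ((apd , _) , a , a<d , 0<a , sa , sb) = ordered (≤-total a b)
    where
    b : ℕ
    b = d ∸ a
    a+b≡d : a + b ≡ d
    a+b≡d = m+[n∸m]≡n (<⇒≤ a<d)
    0<b : 0 < b
    0<b = m<n⇒0<n∸m a<d
    a-summand : Apery⁺ a × a < c
    a-summand = small-summand a+b≡d d<c+m apd sa sb 0<a 0<b
    b-summand : Apery⁺ b × b < c
    b-summand = small-summand (trans (+-comm b a) a+b≡d) d<c+m apd sb sa 0<b 0<a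
    ordered : a ≤ b ⊎ b ≤ a → ∃₂ λ x y → x ≤ y × y < c × Apery⁺ x × Apery⁺ y × d ≡ x + y
    ordered (inj₁ a≤b) = a , b , a≤b , proj₂ b-summand , proj₁ a-summand , proj₁ b-summand , sym a+b≡d
    ordered (inj₂ b≤a) = b , a , b≤a , proj₂ a-summand , proj₁ b-summand , proj₁ a-summand ,
                         trans (sym a+b≡d) (+-comm a b)

  u : ℕ
  u = count Apery⁺? c

  2δ≤u[1+u] : 2 * δ ≤ u * suc u
  2δ≤u[1+u] = count-pair-sums Apery⁺? DecomposableApery? c (c + m) decomposableApery-sum

  NonApery : Pred ℕ 0ℓ
  NonApery = Mem ∩ ∁ Apery

  NonApery? : Decidable NonApery
  NonApery? = Mem? ∩? ∁? Apery?

  nX : ℕ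
  nX = count NonApery? c

  nS : ℕ
  nS = count Mem? c

  1+u+nX≤nS : suc u + nX ≤ nS
  1+u+nX≤nS = begin
    suc u + nX                          ≤⟨ +-monoˡ-≤ nX (s≤s nonzero) ⟩
    suc (count (ApS? ∩? ∁? (_≟ 0)) c) + nX  ≤⟨ +-monoˡ-≤ nX (count-remove ApS? c z<s (zero∈ S , apery-0)) ⟩
    count ApS? c + nX                   ≡⟨ count-partition Mem? Apery? c ⟨
    nS                                  ∎
    where
    open ≤-Reasoning
    ApS? : Decidable (Mem ∩ Apery)
    ApS? = Mem? ∩? Apery?
    nonzero : u ≤ count (ApS? ∩? ∁? (_≟ 0)) c
    nonzero = count-mono Apery⁺? (ApS? ∩? ∁? (_≟ 0)) c
      (λ _ (apx , 0<x) → (proj₁ apx , apx) , λ x≡0 → <-irrefl (sym x≡0) 0<x)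

  nonApery-+* : ∀ {w t} → Apery w → 0 < t → NonApery (w + t * m)
  nonApery-+* {t = suc t} apw _ = mem-+* (suc t) (proj₁ apw) , ¬apery-+m t (proj₁ apw)

  -- Distinct pairs (w , t) with w ∈ Ap and t ≥ 1 give distinct elements w + t·m of S outside Ap.
  Step : ℕ → ℕ → Set
  Step w t = Apery w × 0 < t × w + t * m < c

  record Family (k : ℕ) : Set where
    field
      base     : ℕ → ℕ
      steps    : ℕ → ℕ
      valid    : ∀ {j} → j < k → Step (base j) (steps j)
      distinct : ∀ {i j} → i < k → j < k → base i ≡ base j → steps i ≡ steps j → i ≡ j

  open Family

  family≤nX : ∀ {k} → Family k → k ≤ nX
  family≤nX {k} F = ≤count-by-injection NonApery? k c (λ j → base F j + steps F j * m)
    (λ j<k → let apw , 0<t , lt = valid F j<k in lt , nonApery-+* apw 0<t)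
    (λ {i} {j} i<k j<k eq →
      let bases , stepss = apery-cancel (steps F i) (steps F j) (proj₁ (valid F i<k)) (proj₁ (valid F j<k)) eq
      in distinct F i<k j<k bases stepss)

  chain : ∀ {w} t → Apery w → w + t * m < c → Family t
  chain {w} t apw w+tm<c = record
    { base     = λ _ → w
    ; steps    = suc
    ; valid    = λ j<t → apw , z<s , ≤-<-trans (+-monoʳ-≤ w (*-monoˡ-≤ m j<t)) w+tm<c
    ; distinct = λ _ _ _ → suc-injective
    }

  append : ∀ {k l} (F : Family k) (G : Family l) →
           (∀ {i j} → i < k → j < l → base F i ≢ base G j) → Family (k + l)
  append {k} {l} F G disjoint = record
    { base     = select k (base F) (base G)
    ; steps    = select k (steps F) (steps G)
    ; valid    = valid⊕
    ; distinct = distinct⊕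
    }
    where
    valid⊕ : ∀ {j} → j < k + l → Step (select k (base F) (base G) j) (select k (steps F) (steps G) j)
    valid⊕ j<k+l with <-+-split k l j<k+l
    ... | inj₁ j<k rewrite select-< (base F) (base G) j<k | select-< (steps F) (steps G) j<k = valid F j<k
    ... | inj₂ (i , i<l , refl)
      rewrite select-+ k i (base F) (base G) | select-+ k i (steps F) (steps G) = valid G i<l

    distinct⊕ : ∀ {i j} → i < k + l → j < k + l →
                select k (base F) (base G) i ≡ select k (base F) (base G) j →
                select k (steps F) (steps G) i ≡ select k (steps F) (steps G) j → i ≡ j
    distinct⊕ i<k+l j<k+l with <-+-split k l i<k+l | <-+-split k l j<k+l
    ... | inj₁ i<k | inj₁ j<k
      rewrite select-< (base F) (base G) i<k | select-< (steps F) (steps G) i<k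
            | select-< (base F) (base G) j<k | select-< (steps F) (steps G) j<k = distinct F i<k j<k
    ... | inj₂ (i , i<l , refl) | inj₂ (j , j<l , refl)
      rewrite select-+ k i (base F) (base G) | select-+ k i (steps F) (steps G)
            | select-+ k j (base F) (base G) | select-+ k j (steps F) (steps G) =
      λ bases stepss → cong (k +_) (distinct G i<l j<l bases stepss)
    ... | inj₁ i<k | inj₂ (j , j<l , refl)
      rewrite select-< (base F) (base G) i<k | select-+ k j (base F) (base G) =
      λ bases _ → contradiction bases (disjoint i<k j<l)
    ... | inj₂ (i , i<l , refl) | inj₁ j<k
      rewrite select-+ k i (base F) (base G) | select-< (base F) (base G) j<k =
      λ bases _ → contradiction (sym bases) (disjoint j<k i<l)

  GoodPair : Set
  GoodPair = ∃ λ b → b < c × ∃ λ a → a < b × Apery⁺ a × Apery⁺ b × a + b < c + m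

  GoodPair? : Dec GoodPair
  GoodPair? = anyUpTo? (λ b → anyUpTo? (λ a → Apery⁺? a ×-dec Apery⁺? b ×-dec a + b <? c + m) b) c

  δ≤1 : ¬ GoodPair → δ ≤ 1
  δ≤1 ¬good = count≤1 DecomposableApery? (c + m) same
    where
    double : ∀ {d} → d < c + m → DecomposableApery d → ∃ λ x → x < c × Apery⁺ x × d ≡ x + x
    double d<c+m dd with decomposableApery-sum d<c+m dd
    ... | x , y , x≤y , y<c , x⁺ , y⁺ , d≡x+y with m≤n⇒m<n∨m≡n x≤y
    ...   | inj₂ refl = x , y<c , x⁺ , d≡x+y
    ...   | inj₁ x<y  = contradiction (y , y<c , x , x<y , x⁺ , y⁺ , subst (_< c + m) d≡x+y d<c+m) ¬good

    smaller-double : ∀ {x y} → x < y → y < c → Apery⁺ x → Apery⁺ y → y + y < c + m → ⊥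
    smaller-double x<y y<c x⁺ y⁺ 2y<c+m =
      ¬good (_ , y<c , _ , x<y , x⁺ , y⁺ , ≤-<-trans (+-monoˡ-≤ _ (<⇒≤ x<y)) 2y<c+m)

    same : ∀ {d d′} → d < c + m → d′ < c + m → DecomposableApery d → DecomposableApery d′ → d ≡ d′
    same d<c+m d′<c+m dd dd′ with double d<c+m dd | double d′<c+m dd′
    ... | x , x<c , x⁺ , refl | y , y<c , y⁺ , refl with <-cmp x y
    ...   | tri≈ _ refl _ = refl
    ...   | tri< x<y _ _ = ⊥-elim (smaller-double x<y y<c x⁺ y⁺ d′<c+m)
    ...   | tri> _ _ y<x = ⊥-elim (smaller-double y<x x<c y⁺ x⁺ d<c+m)

  δ≤ρ : ∀ {ρ} → c + ρ ≡ 3 * m → (∀ {x} → x < c → Apery⁺ x → c ≤ x + m) → δ ≤ ρ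
  δ≤ρ {ρ} c+ρ≡3m short = begin
    δ                      ≤⟨ count≤-above DecomposableApery? (c + m ∸ ρ) (c + m) large ⟩
    c + m ∸ (c + m ∸ ρ)    ≤⟨ m≤n+o⇒m∸n≤o (c + m) (c + m ∸ ρ) (subst (c + m ≤_) (+-comm ρ _) (m≤n+m∸n (c + m) ρ)) ⟩
    ρ                      ∎
    where
    open ≤-Reasoning
    large : ∀ {d} → d < c + m → DecomposableApery d → c + m ∸ ρ ≤ d
    large d<c+m dd with decomposableApery-sum d<c+m dd
    ... | x , y , x≤y , y<c , x⁺ , y⁺ , refl = m≤n+o⇒m∸n≤o (c + m) ρ
      (large-summands⇒c+m≤ρ+[x+y] c+ρ≡3m (short (≤-<-trans x≤y y<c) x⁺) (short y<c y⁺))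

  δ≤2u : ∀ {a b} → 3 * m ≤ c → (∀ {x} → x < c → Apery⁺ x → x + m < c → x ≡ a ⊎ x ≡ b) → δ ≤ 2 * u
  δ≤2u {a} {b} 3m≤c long⇒a∨b = begin
    δ                                                 ≤⟨ count-union DecomposableApery? (Shift? a) (Shift? b) (c + m) cover ⟩
    count (Shift? a) (c + m) + count (Shift? b) (c + m)  ≤⟨ +-mono-≤ (shifts a) (shifts b) ⟩
    u + u                                             ≡⟨ cong (u +_) (+-identityʳ u) ⟨
    2 * u                                             ∎
    where
    open ≤-Reasoning
    Shift : ℕ → Pred ℕ 0ℓ
    Shift w d = w ≤ d × Apery⁺ (d ∸ w) × d ∸ w < c

    Shift? : ∀ w → Decidable (Shift w)
    Shift? w d = w ≤? d ×-dec Apery⁺? (d ∸ w) ×-dec d ∸ w <? c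

    shifts : ∀ w → count (Shift? w) (c + m) ≤ u
    shifts w = count-injective (Shift? w) Apery⁺? (c + m) c (_∸ w) (λ _ (_ , y⁺ , y<c) → y<c , y⁺)
      (λ _ _ (w≤d , _) (w≤d′ , _) → ∸-cancelʳ-≡ w≤d w≤d′)

    shift : ∀ {x y} → Apery⁺ y → y < c → Shift x (x + y)
    shift {x} {y} y⁺ y<c = m≤m+n x y , subst Apery⁺ (sym (m+n∸m≡n x y)) y⁺ , subst (_< c) (sym (m+n∸m≡n x y)) y<c

    long-summand : ∀ {x y} → x < c → Apery⁺ x → x + m < c → Apery⁺ y → y < c → Shift a (x + y) ⊎ Shift b (x + y)
    long-summand x<c x⁺ x+m<c y⁺ y<c with long⇒a∨b x<c x⁺ x+m<c
    ... | inj₁ refl = inj₁ (shift y⁺ y<c)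
    ... | inj₂ refl = inj₂ (shift y⁺ y<c)

    cover : ∀ {d} → d < c + m → DecomposableApery d → Shift a d ⊎ Shift b d
    cover d<c+m dd with decomposableApery-sum d<c+m dd
    ... | x , y , x≤y , y<c , x⁺ , y⁺ , refl with x + m <? c | y + m <? c
    ...   | yes x+m<c | _         = long-summand (≤-<-trans x≤y y<c) x⁺ x+m<c y⁺ y<c
    ...   | no _      | yes y+m<c = subst (λ d → Shift a d ⊎ Shift b d) (+-comm y x)
                                          (long-summand y<c y⁺ y+m<c x⁺ (≤-<-trans x≤y y<c))
    ...   | no x+m≮c  | no y+m≮c  =
      contradiction (large-summands⇒c+m≤x+y 3m≤c (≮⇒≥ x+m≮c) (≮⇒≥ y+m≮c)) (<⇒≱ d<c+m)

  module Chains {p : ℕ} (pm<c : p * m < c) where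

    multiples : Family p
    multiples = chain p apery-0 pm<c

    p≤nX : p ≤ nX
    p≤nX = family≤nX multiples

    single : ∀ {e} → Apery e → e + m < c → Family 1
    single {e} ape e+m<c = chain 1 ape (subst (λ z → e + z < c) (sym (+-identityʳ m)) e+m<c)

    long⇒1+p≤nX : ∀ {e} → Apery⁺ e → e + m < c → suc p ≤ nX
    long⇒1+p≤nX (ape , 0<e) e+m<c = subst (_≤ nX) (+-comm p 1)
      (family≤nX (append multiples (single ape e+m<c) (λ _ _ 0≡e → <-irrefl 0≡e 0<e)))

    -- The chain of a runs up to its last multiple ka below c; then b < (2 + ka)·m, which leaves room for
    -- r ∸ ka steps from b.
    module _ {r a b : ℕ} (2+r≤p : 2 + r ≤ p) (a<b : a < b) (b<c : b < c)
             (a⁺ : Apery⁺ a) (b⁺ : Apery⁺ b) (a+b<c+m : a + b < c + m) where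

      private
        a-last : ∃ λ t → a + t * m < c × c ≤ a + suc t * m
        a-last = last-multiple-below m c 0<m (<-trans a<b b<c)

        ka kb : ℕ
        ka = proj₁ a-last
        kb = r ∸ ka

        b<[2+ka]m : b < (2 + ka) * m
        b<[2+ka]m = +-cancelˡ-< a b _ (begin-strict
          a + b                 <⟨ a+b<c+m ⟩
          c + m                 ≤⟨ +-monoˡ-≤ m (proj₂ (proj₂ a-last)) ⟩
          a + suc ka * m + m    ≡⟨ +-assoc a (suc ka * m) m ⟩
          a + (suc ka * m + m)  ≡⟨ cong (a +_) (+-comm (suc ka * m) m) ⟩
          a + (2 + ka) * m      ∎)
          where open ≤-Reasoning

        b-steps : b + kb * m < c
        b-steps with ka <? r
        ... | no ka≮r = subst (λ k → b + k * m < c) (sym (m≤n⇒m∸n≡0 (≮⇒≥ ka≮r)))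
                              (subst (_< c) (sym (+-identityʳ b)) b<c)
        ... | yes ka<r = begin-strict
          b + kb * m             <⟨ +-monoˡ-< (kb * m) b<[2+ka]m ⟩
          (2 + ka) * m + kb * m  ≡⟨ *-distribʳ-+ m (2 + ka) kb ⟨
          (2 + (ka + kb)) * m    ≡⟨ cong (λ k → (2 + k) * m) (m+[n∸m]≡n (<⇒≤ ka<r)) ⟩
          (2 + r) * m            ≤⟨ *-monoˡ-≤ m 2+r≤p ⟩
          p * m                  <⟨ pm<c ⟩
          c                      ∎
          where open ≤-Reasoning

        pair-chains : Family (ka + kb)
        pair-chains = append (chain ka (proj₁ a⁺) (proj₁ (proj₂ a-last))) (chain kb (proj₁ b⁺) b-steps)
                             (λ _ _ a≡b → <-irrefl a≡b a<b)

        all-chains : Family (p + (ka + kb))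
        all-chains = append multiples pair-chains
          (λ {_} {j} _ _ → select-preserves {P = 0 ≢_} ka (λ _ 0≡a → <-irrefl 0≡a (proj₂ a⁺))
                                                           (λ _ 0≡b → <-irrefl 0≡b (proj₂ b⁺)) j)

        r+p≤p+[ka+kb] : r + p ≤ p + (ka + kb)
        r+p≤p+[ka+kb] = subst (_≤ p + (ka + kb)) (+-comm p r) (+-monoʳ-≤ p (m≤n+m∸n r ka))

      goodPair⇒r+p≤nX : r + p ≤ nX
      goodPair⇒r+p≤nX = ≤-trans r+p≤p+[ka+kb] (family≤nX all-chains)

      goodPair+long⇒1+r+p≤nX : ∀ {e} → Apery⁺ e → e + m < c → e ≢ a → e ≢ b → suc (r + p) ≤ nX
      goodPair+long⇒1+r+p≤nX {e} (ape , 0<e) e+m<c e≢a e≢b = begin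
        suc (r + p)             ≤⟨ s≤s r+p≤p+[ka+kb] ⟩
        suc (p + (ka + kb))     ≡⟨ +-comm 1 (p + (ka + kb)) ⟩
        p + (ka + kb) + 1       ≤⟨ family≤nX (append all-chains (single ape e+m<c) disjoint) ⟩
        nX                      ∎
        where
        open ≤-Reasoning
        disjoint : ∀ {i j} → i < p + (ka + kb) → j < 1 → base all-chains i ≢ e
        disjoint {i} _ _ = select-preserves {P = _≢ e} p (λ _ 0≡e → <-irrefl 0≡e 0<e)
          (select-preserves {P = _≢ e} ka (λ _ a≡e → e≢a (sym a≡e)) (λ _ b≡e → e≢b (sym b≡e))) i

module Wilf (S : NumericalSemigroup) {f m ν ρ α : ℕ}
            (frob : IsFrobenius S f) (mult : IsMultiplicity S m) (emb : IsEmbeddingDimension S ν)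
            (ρ<m : ρ < m) (hα : α * (α ∸ 1) ≤ 2 * (m ∸ ν) + 2) (7≤α : 7 ≤ α) where

  open Semigroup S frob mult

  private
    a : ℕ
    a = α ∸ 3

    3≤α : 3 ≤ α
    3≤α = ≤-trans (s≤s (s≤s (s≤s z≤n))) 7≤α

    3+a≡α : 3 + a ≡ α
    3+a≡α = m+[n∸m]≡n 3≤α

    α[α∸1]≤2δ+2 : α * (α ∸ 1) ≤ 2 * δ + 2
    α[α∸1]≤2δ+2 = ≤-trans hα (+-monoˡ-≤ 2 (*-monoʳ-≤ 2 (m≤n+o⇒m∸n≤o m ν (m≤ν+δ emb))))

    α≤1+u : α ≤ suc u
    α≤1+u = α[α∸1]≤u[1+u]+2⇒α≤1+u 3≤α (≤-trans α[α∸1]≤2δ+2 (+-monoˡ-≤ 2 2δ≤u[1+u]))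

    ¬α[α∸1]≤2x+2 : ∀ {x} → x ≤ 1 → ¬ α * (α ∸ 1) ≤ 2 * x + 2
    ¬α[α∸1]≤2x+2 x≤1 le = <⇒≱ (4<α[α∸1] 3≤α) (≤-trans le (+-monoˡ-≤ 2 (*-monoʳ-≤ 2 x≤1)))

    ν≤m : ν ≤ m
    ν≤m with ν ≤? m
    ... | yes ν≤m = ν≤m
    ... | no  ν≰m = contradiction hα (¬α[α∸1]≤2x+2 (subst (_≤ 1) (sym m∸ν≡0) z≤n))
      where
      m∸ν≡0 : m ∸ ν ≡ 0
      m∸ν≡0 = m≤n⇒m∸n≡0 (<⇒≤ (≰⇒> ν≰m))

    goodPair : GoodPair
    goodPair with GoodPair?
    ... | yes good = good
    ... | no ¬good = contradiction α[α∸1]≤2δ+2 (¬α[α∸1]≤2x+2 (δ≤1 ¬good))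

    few⇒3+nX<2q : ∀ q → nS < 2 * q + a → 3 + nX < 2 * q
    few⇒3+nX<2q q few = +-cancelʳ-< a (3 + nX) (2 * q) (begin-strict
      3 + nX + a   ≡⟨ trans (+-assoc 3 nX a) (cong (3 +_) (+-comm nX a)) ⟩
      3 + (a + nX) ≡⟨ cong (_+ nX) 3+a≡α ⟩
      α + nX       ≤⟨ +-monoˡ-≤ nX α≤1+u ⟩
      suc u + nX   ≤⟨ 1+u+nX≤nS ⟩
      nS           <⟨ few ⟩
      2 * q + a    ∎)
      where open ≤-Reasoning

    wilf-q≡3 : c + ρ ≡ 3 * m → 3 * m ≤ (6 + a) * ν → 3 + nX < 6 → c ≤ ν * nS
    wilf-q≡3 c+ρ≡3m 3m≤[6+a]ν 3+nX<6 = c+ρ≡3m⇒c≤νn c+ρ≡3m m∸ν≤ρ ν≤m 3m≤[6+a]ν 5+a≤nS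
      where
      open Chains {p = 2} (c+ρ≡[1+p]m⇒pm<c {p = 2} c+ρ≡3m ρ<m)
      short : ∀ {x} → x < c → Apery⁺ x → c ≤ x + m
      short {x} _ x⁺ with x + m <? c
      ... | yes long = contradiction (long⇒1+p≤nX x⁺ long) (<⇒≱ (s≤s (+-cancelˡ-≤ 4 nX 2 3+nX<6)))
      ... | no ¬long = ≮⇒≥ ¬long
      m∸ν≤ρ : m ∸ ν ≤ ρ
      m∸ν≤ρ = ≤-trans (m≤n+o⇒m∸n≤o m ν (m≤ν+δ emb)) (δ≤ρ c+ρ≡3m short)
      5+a≤nS : 5 + a ≤ nS
      5+a≤nS = begin
        5 + a         ≡⟨ +-comm 2 (3 + a) ⟩
        3 + a + 2     ≤⟨ +-mono-≤ (≤-trans (≤-reflexive 3+a≡α) α≤1+u) p≤nX ⟩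
        suc u + nX    ≤⟨ 1+u+nX≤nS ⟩
        nS            ∎
        where open ≤-Reasoning

    wilf-q≥4 : ∀ {r} → 1 ≤ r → (2 + r) * m < c → nS < 2 * (3 + r) + a → 3 + nX < 2 * (3 + r) → GoodPair → ⊥
    wilf-q≥4 {r} 1≤r pm<c few 3+nX<2q (b , b<c , a′ , a′<b , a′⁺ , b⁺ , a′+b<c+m) =
      let e , _ , e⁺ , e+m<c , e≢a′ , e≢b = another-long
      in <⇒≱ 3+nX<2q (≤-trans (≤-reflexive (regroup r))
                               (+-monoʳ-≤ 3 (goodPair+long⇒1+r+p≤nX ≤-refl a′<b b<c a′⁺ b⁺ a′+b<c+m e⁺ e+m<c e≢a′ e≢b)))
      where
      open Chains {p = 2 + r} pm<c
      regroup : ∀ r → 2 * (3 + r) ≡ 3 + suc (r + (2 + r))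
      regroup = solve-∀

      u<α : u < α
      u<α = subst (u <_) 3+a≡α (+-cancelʳ-< (r + (2 + r)) u (3 + a) (s≤s⁻¹ (begin-strict
        suc u + (r + (2 + r))         ≤⟨ +-monoʳ-≤ (suc u) (goodPair⇒r+p≤nX ≤-refl a′<b b<c a′⁺ b⁺ a′+b<c+m) ⟩
        suc u + nX                    ≤⟨ 1+u+nX≤nS ⟩
        nS                            <⟨ few ⟩
        2 * (3 + r) + a               ≡⟨ regroup′ r a ⟩
        suc (3 + a + (r + (2 + r)))   ∎)))
        where
        open ≤-Reasoning
        regroup′ : ∀ r a → 2 * (3 + r) + a ≡ suc (3 + a + (r + (2 + r)))
        regroup′ = solve-∀

      another-long : ∃ λ e → e < c × Apery⁺ e × e + m < c × e ≢ a′ × e ≢ b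
      another-long with anyUpTo? (λ e → Apery⁺? e ×-dec e + m <? c ×-dec ¬? (e ≟ a′) ×-dec ¬? (e ≟ b)) c
      ... | yes found = found
      ... | no ¬other = contradiction (≤-trans α[α∸1]≤2δ+2 (+-monoˡ-≤ 2 2δ≤4u))
                                      (<⇒≱ (4u+2<α[α∸1] (≤-trans (s≤s (s≤s (s≤s (s≤s (s≤s z≤n))))) 7≤α) u<α))
        where
        only-a′-b : ∀ {x} → x < c → Apery⁺ x → x + m < c → x ≡ a′ ⊎ x ≡ b
        only-a′-b {x} x<c x⁺ x+m<c with x ≟ a′ | x ≟ b
        ... | yes x≡a′ | _       = inj₁ x≡a′
        ... | no _     | yes x≡b = inj₂ x≡b
        ... | no x≢a′  | no x≢b  = contradiction (x , x<c , x⁺ , x+m<c , x≢a′ , x≢b) ¬other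
        3m≤c : 3 * m ≤ c
        3m≤c = <⇒≤ (≤-<-trans (*-monoˡ-≤ m (s≤s (s≤s 1≤r))) pm<c)
        2δ≤4u : 2 * δ ≤ 4 * u
        2δ≤4u = ≤-trans (*-monoʳ-≤ 2 (δ≤2u 3m≤c only-a′-b)) (≤-reflexive (sym (*-assoc 2 2 u)))

  wilf : ∀ q → c + ρ ≡ q * m → q * m ≤ (2 * q + a) * ν → c ≤ ν * nS
  wilf q c+ρ≡qm qm≤[2q+a]ν with 2 * q + a ≤? nS
  ... | yes enough = begin
    c                  ≤⟨ m≤m+n c ρ ⟩
    c + ρ              ≡⟨ c+ρ≡qm ⟩
    q * m              ≤⟨ qm≤[2q+a]ν ⟩
    (2 * q + a) * ν    ≤⟨ *-monoˡ-≤ ν enough ⟩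
    nS * ν             ≡⟨ *-comm nS ν ⟩
    ν * nS             ∎
    where open ≤-Reasoning
  ... | no ¬enough = by-q q c+ρ≡qm qm≤[2q+a]ν (≰⇒> ¬enough)
    where
    by-q : ∀ q → c + ρ ≡ q * m → q * m ≤ (2 * q + a) * ν → nS < 2 * q + a → c ≤ ν * nS
    by-q zero () _ _
    by-q 1 _ _ few with few⇒3+nX<2q 1 few
    ... | s≤s (s≤s ())
    by-q 2 c+ρ≡2m _ few = contradiction (Chains.p≤nX {p = 1} (c+ρ≡[1+p]m⇒pm<c {p = 1} c+ρ≡2m ρ<m))
                                        (<⇒≱ (+-cancelˡ-< 3 nX 1 (few⇒3+nX<2q 2 few)))
    by-q 3 c+ρ≡3m 3m≤[6+a]ν few = wilf-q≡3 c+ρ≡3m 3m≤[6+a]ν (few⇒3+nX<2q 3 few)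
    by-q (suc (suc (suc (suc r)))) c+ρ≡qm _ few =
      ⊥-elim (wilf-q≥4 z<s (c+ρ≡[1+p]m⇒pm<c {p = 3 + r} c+ρ≡qm ρ<m) few (few⇒3+nX<2q (4 + r) few) goodPair)

corollary7 : (S : NumericalSemigroup) (f m ν q ρ α : ℕ) →
    IsFrobenius S f → IsMultiplicity S m → IsEmbeddingDimension S ν →
    f + 1 + ρ ≡ q * m → ρ < m →
    α * (α ∸ 1) ≤ 2 * (m ∸ ν) + 2 →
    7 ≤ α → α + 2 ≤ m →
    q * m ≤ (2 * q + (α ∸ 3)) * ν →
    f + 1 ≤ ν * count< S f
corollary7 S f m ν q ρ α frob mult emb f+1+ρ≡qm ρ<m hα 7≤α _ hH =
  subst₂ (λ c n → c ≤ ν * n) (+-comm 1 f) nS≡count< (wilf q c+ρ≡qm hH)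
  where
  open Semigroup S frob mult using (Mem?; ¬mem-f; nS)
  open Wilf S frob mult emb ρ<m hα 7≤α using (wilf)
  c+ρ≡qm : suc f + ρ ≡ q * m
  c+ρ≡qm = trans (cong (_+ ρ) (+-comm 1 f)) f+1+ρ≡qm
  nS≡count< : nS ≡ count< S f
  nS≡count< = trans (count-suc-∉ Mem? ¬mem-f) (sym (length-filterᵇ-upTo (mem S) f))
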